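{- Let $P$ be a prime filter of a residuated lattice $L$. If $P$ is not essential in $L$, then $P$ is a minimal prime filter of $L$.
   Context: A residuated lattice is an algebra $(L,\wedge,\vee,\odot,\rightarrow,0,1)$ such that $(L,\wedge,\vee,0,1)$ is a bounded lattice, $(L,\odot,1)$ is a commutative monoid, and $x\odot z\le y$ iff $z\le x\rightarrow y$. A filter is a nonempty subset closed under $\odot$ and upward closed. A proper filter $P$ is prime if $x\vee y\in P$ implies $x\in P$ or $y\in P$; it is minimal prime if no prime filter is strictly contained in it. A filter $H$ is essential in $L$ if for every filter $G$, $H\cap G=\{1\}$ implies $G=\{1\}$. -}

module Defs where

open import Level using (Level; suc; _⊔_)
open import Relation.Binary.PropositionalEquality using (_≡_)
open import Algebra.Core using (Op₂)
open import Algebra.Structures using (IsCommutativeMonoid)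
open import Algebra.Lattice.Structures using (IsLattice)
open import Data.Product using (Σ; _×_)
open import Data.Sum using (_⊎_)
open import Relation.Nullary using (¬_)

record ResiduatedLattice (c : Level) : Set (suc c) where
  infixr 6 _∨_
  infixr 7 _∧_
  infixr 7 _⊙_
  infixr 5 _⇒_
  infix  4 _≤_
  field
    Carrier : Set c
    _∧_ _∨_ _⊙_ _⇒_ : Op₂ Carrier
    𝟘 𝟙 : Carrier
    isLattice : IsLattice _≡_ _∨_ _∧_
  _≤_ : Carrier → Carrier → Set c
  x ≤ y = x ∧ y ≡ x
  field
    𝟘-least   : ∀ x → 𝟘 ≤ x
    𝟙-greatest : ∀ x → x ≤ 𝟙
    ⊙-isCommutativeMonoid : IsCommutativeMonoid _≡_ _⊙_ 𝟙
    residuation-⇒ : ∀ x y z → x ⊙ z ≤ y → z ≤ (x ⇒ y)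
    residuation-⇐ : ∀ x y z → z ≤ (x ⇒ y) → x ⊙ z ≤ y

module _ {c : Level} (L : ResiduatedLattice c) where
  open ResiduatedLattice L

  Subset : (ℓ : Level) → Set (c ⊔ suc ℓ)
  Subset ℓ = Carrier → Set ℓ

  _⊆_ : {ℓ ℓ' : Level} → Subset ℓ → Subset ℓ' → Set (c ⊔ ℓ ⊔ ℓ')
  A ⊆ B = ∀ x → A x → B x

  record IsFilter {ℓ : Level} (F : Subset ℓ) : Set (c ⊔ ℓ) where
    field
      nonempty  : Σ Carrier F
      ⊙-closed  : ∀ x y → F x → F y → F (x ⊙ y)
      up-closed : ∀ x y → F x → x ≤ y → F y

  IsProper : {ℓ : Level} → Subset ℓ → Set (c ⊔ ℓ)
  IsProper F = ¬ (∀ x → F x)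

  record IsPrimeFilter {ℓ : Level} (P : Subset ℓ) : Set (c ⊔ ℓ) where
    field
      isFilter : IsFilter P
      proper   : IsProper P
      prime    : ∀ x y → P (x ∨ y) → P x ⊎ P y

  _⊊_ : {ℓ ℓ' : Level} → Subset ℓ → Subset ℓ' → Set (c ⊔ ℓ ⊔ ℓ')
  Q ⊊ P = (Q ⊆ P) × Σ Carrier (λ x → P x × ¬ Q x)

  -- minimal prime filter: prime, and no prime filter (of the same
  -- universe level) is strictly contained in it
  IsMinimalPrimeFilter : {ℓ : Level} → Subset ℓ → Set (c ⊔ suc ℓ)
  IsMinimalPrimeFilter {ℓ} P =
    IsPrimeFilter P ×
    (∀ (Q : Subset ℓ) → IsPrimeFilter Q → ¬ (Q ⊊ P))

  MeetsTrivially : {ℓ ℓ' : Level} → Subset ℓ → Subset ℓ' → Set (c ⊔ ℓ ⊔ ℓ')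
  MeetsTrivially H G = ∀ x → H x → G x → x ≡ 𝟙

  -- G = {1}   (for a filter, which always contains 1)
  IsTrivial : {ℓ : Level} → Subset ℓ → Set (c ⊔ ℓ)
  IsTrivial G = ∀ x → G x → x ≡ 𝟙

  IsEssential : {ℓ : Level} → Subset ℓ → Set (c ⊔ suc ℓ)
  IsEssential {ℓ} H =
    ∀ (G : Subset ℓ) → IsFilter G → MeetsTrivially H G → IsTrivial G

{-# OPTIONS --safe #-}

-- A filter P strictly containing a prime filter Q is essential; take x ∈ P ∖ Q: for a
-- filter G with P ∩ G = {1} and g ∈ G, the join x ∨ g lies in P ∩ G, hence
-- equals 1 and lies in Q. Primeness of Q and x ∉ Q give g ∈ Q ⊆ P, so
-- g ∈ P ∩ G, i.e. g = 1.
module Submission where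

open import Defs
open import Level using (Level)
open import Relation.Nullary using (¬_)
open import Relation.Binary.PropositionalEquality using (_≡_; subst; sym)
open import Data.Product using (_,_; proj₁; proj₂)
open import Data.Sum using (inj₁; inj₂)
open import Data.Empty using (⊥-elim)
open import Algebra.Lattice.Structures using (IsLattice)

module _ {c : Level} (L : ResiduatedLattice c) where
  open ResiduatedLattice L
  open IsLattice isLattice using (absorptive; ∨-comm)

  x≤x∨y : ∀ x y → x ≤ x ∨ y
  x≤x∨y = proj₂ absorptive

  y≤x∨y : ∀ x y → y ≤ x ∨ y
  y≤x∨y x y = subst (λ z → y ≤ z) (∨-comm y x) (x≤x∨y y x)

  filter-contains-𝟙 : {ℓ : Level} {F : Subset L ℓ} → IsFilter L F → F 𝟙
  filter-contains-𝟙 F-filter =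
    up-closed (proj₁ nonempty) 𝟙 (proj₂ nonempty) (𝟙-greatest _)
    where open IsFilter F-filter

  join-≡-𝟙-of-meetsTrivially :
    {ℓ ℓ' : Level} {F : Subset L ℓ} {G : Subset L ℓ'} →
    IsFilter L F → IsFilter L G → MeetsTrivially L F G →
    ∀ {x g} → F x → G g → x ∨ g ≡ 𝟙
  join-≡-𝟙-of-meetsTrivially F-filter G-filter F∩G≡𝟙 {x} {g} Fx Gg =
    F∩G≡𝟙 (x ∨ g)
      (IsFilter.up-closed F-filter x (x ∨ g) Fx (x≤x∨y x g))
      (IsFilter.up-closed G-filter g (x ∨ g) Gg (y≤x∨y x g))

  ⊋primeFilter⇒essential :
    {ℓ ℓ' : Level} {P : Subset L ℓ} {Q : Subset L ℓ'} →
    IsFilter L P → IsPrimeFilter L Q → _⊊_ L Q P → IsEssential L P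
  ⊋primeFilter⇒essential {Q = Q} P-filter Q-prime (Q⊆P , x , Px , x∉Q)
                         G G-filter P∩G≡𝟙 g Gg
    with IsPrimeFilter.prime Q-prime x g Q[x∨g]
    where
    Q[x∨g] : Q (x ∨ g)
    Q[x∨g] = subst Q (sym (join-≡-𝟙-of-meetsTrivially P-filter G-filter P∩G≡𝟙 Px Gg))
                     (filter-contains-𝟙 (IsPrimeFilter.isFilter Q-prime))
  ... | inj₁ Qx = ⊥-elim (x∉Q Qx)
  ... | inj₂ Qg = P∩G≡𝟙 g (Q⊆P g Qg) Gg

proposition2p23 : {c ℓ : Level} (L : ResiduatedLattice c) (P : Subset L ℓ) →
    IsPrimeFilter L P → ¬ IsEssential L P → IsMinimalPrimeFilter L P
proposition2p23 L P P-prime P-inessential =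
  P-prime , λ Q Q-prime Q⊊P →
    P-inessential (⊋primeFilter⇒essential L (IsPrimeFilter.isFilter P-prime) Q-prime Q⊊P)
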